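{- Let $H$ be a permutation group on a finite nonempty set $\Omega$, let $G$ be a finite group and let $X=G\wr_\Omega H$. Suppose that (a) there is an inverse-closed generating set $S$ for $G$ and a non-identity bijection $\tau\colon G\to G$ such that $\tau(1)=1$ and, for every $g\in G$ and every $s\in S$, $\tau(sg)\in\{s\tau(g),s^{ -1}\tau(g)\}$; and (b) either $H$ is nontrivial or $\tau\notin\mathrm{Aut}(G)$. Then $X$ is non-CCA.
   Context: All groups and graphs are finite. $G\wr_\Omega H=G^\Omega\rtimes H$ with $H$ permuting the coordinates. For a group $G$ and inverse-closed $S\subseteq G$, $\mathrm{Cay}(G,S)$ is the edge-coloured graph on $G$ with edges $\{g,sg\}$ ($g\in G,s\in S$) coloured $\{s,s^{ -1}\}$. $\mathrm{Aut}_c$ is the group of colour-preserving graph automorphisms, $G_R$ the right regular representation, $\mathrm{Aut}_{\pm1}(G,S)=\{\alpha\in\mathrm{Aut}(G)\colon s^\alpha\in\{s,s^{ -1}\}\ \forall s\in S\}$. $\mathrm{Cay}(G,S)$ is CCA if $\mathrm{Aut}_c(\mathrm{Cay}(G,S))=G_R\rtimes\mathrm{Aut}_{\pm1}(G,S)$. A group is CCA if every connected Cayley graph on it is CCA, and non-CCA otherwise. -}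

module Defs where

open import Level using (0ℓ)
open import Data.Nat using (ℕ)
open import Data.Fin using (Fin)
open import Data.Vec using (Vec; zipWith; tabulate; lookup; replicate; map)
open import Data.List using (List; foldr)
open import Data.List.Relation.Unary.All using (All)
open import Data.Product using (Σ; ∃; ∃-syntax; Σ-syntax; _×_; _,_)
open import Data.Sum using (_⊎_)
open import Relation.Nullary using (¬_)
open import Relation.Binary.PropositionalEquality using (_≡_)
open import Function.Bundles using (_↔_)
open import Algebra.Structures using (IsGroup)

record RawGrp : Set₁ where
  infixl 7 _∙_
  infix 8 _⁻¹
  field
    Carrier : Set
    _∙_     : Carrier → Carrier → Carrier
    ε       : Carrier
    _⁻¹     : Carrier → Carrier

record FinGroup : Set₁ where
  infixl 7 _∙_
  infix 8 _⁻¹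
  field
    Carrier : Set
    _∙_     : Carrier → Carrier → Carrier
    ε       : Carrier
    _⁻¹     : Carrier → Carrier
    isGroup : IsGroup _≡_ _∙_ ε _⁻¹
    size    : ℕ
    finite  : Carrier ↔ Fin size

  raw : RawGrp
  raw = record { Carrier = Carrier ; _∙_ = _∙_ ; ε = ε ; _⁻¹ = _⁻¹ }

-- A permutation group H on Ω = Fin k, given as a finite group together
-- with a faithful (left) action on Ω, i.e. an injective homomorphism
-- H → Sym(Ω).

record PermAction (H : FinGroup) (k : ℕ) : Set where
  open FinGroup H
  field
    act      : Carrier → Fin k → Fin k
    act-ε    : ∀ ω → act ε ω ≡ ω
    act-∙    : ∀ h h′ ω → act (h ∙ h′) ω ≡ act h (act h′ ω)
    faithful : ∀ h → (∀ ω → act h ω ≡ ω) → h ≡ ε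

-- Wreath product X = G ≀_Ω H = G^Ω ⋊ H, Ω = Fin k, with
-- G^Ω represented by Vec G k, H permuting coordinates via
-- (h · f)(ω) = f(h⁻¹ ω), and
-- (f , h)(f′ , h′) = (f · (h · f′) , h h′).

module _ (G H : FinGroup) {k : ℕ} (A : PermAction H k) where
  private
    module G = FinGroup G
    module H = FinGroup H
    open PermAction A

  permute : H.Carrier → Vec G.Carrier k → Vec G.Carrier k
  permute h f = tabulate (λ ω → lookup f (act (h H.⁻¹) ω))

  Wreath : RawGrp
  Wreath = record
    { Carrier = Vec G.Carrier k × H.Carrier
    ; _∙_ = λ { (f , h) (f′ , h′) → (zipWith G._∙_ f (permute h f′) , h H.∙ h′) }
    ; ε   = (replicate k G.ε , H.ε)
    ; _⁻¹ = λ { (f , h) → (permute (h H.⁻¹) (map G._⁻¹ f) , h H.⁻¹) }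
    }

module CayleyNotions (X : RawGrp) where
  open RawGrp X

  InvClosed : (Carrier → Set) → Set
  InvClosed S = ∀ s → S s → S (s ⁻¹)

  applyWord : List Carrier → Carrier → Carrier
  applyWord ss x = foldr _∙_ x ss

  Generates : (Carrier → Set) → Set
  Generates S = ∀ g → ∃[ ss ] (All S ss × g ≡ applyWord ss ε)

  -- Cay(X,S) is connected: any two vertices are joined by a walk
  -- x, s₁x, s₂s₁x, … along edges of the Cayley graph.
  Connected : (Carrier → Set) → Set
  Connected S = ∀ x y → ∃[ ss ] (All S ss × y ≡ applyWord ss x)

  -- φ sends each edge {g, s g} (colour {s,s⁻¹}) to an edge of the same
  -- colour, i.e. φ(s g) ∈ {s φ(g), s⁻¹ φ(g)}.
  ColourPres : (Carrier → Set) → (Carrier → Carrier) → Set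
  ColourPres S φ = ∀ g s → S s →
    (φ (s ∙ g) ≡ s ∙ φ g) ⊎ (φ (s ∙ g) ≡ (s ⁻¹) ∙ φ g)

  IsBijection : (Carrier → Carrier) → Set
  IsBijection φ = Σ[ ψ ∈ (Carrier → Carrier) ] ((∀ x → ψ (φ x) ≡ x) × (∀ x → φ (ψ x) ≡ x))

  AutC : (Carrier → Set) → (Carrier → Carrier) → Set
  AutC S φ = Σ[ ψ ∈ (Carrier → Carrier) ] ((∀ x → ψ (φ x) ≡ x) × (∀ x → φ (ψ x) ≡ x)
                                     × ColourPres S φ × ColourPres S ψ)

  IsAut : (Carrier → Carrier) → Set
  IsAut α = IsBijection α × (∀ x y → α (x ∙ y) ≡ α x ∙ α y)

  AutPM : (Carrier → Set) → (Carrier → Carrier) → Set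
  AutPM S α = IsAut α × (∀ s → S s → (α s ≡ s) ⊎ (α s ≡ s ⁻¹))

  -- membership in X_R ⋊ Aut_{±1}(X,S) (as a group of permutations of X):
  -- φ = x ↦ α(x) g
  InRegAut : (Carrier → Set) → (Carrier → Carrier) → Set
  InRegAut S φ = ∃[ g ] ∃[ α ] (AutPM S α × (∀ x → φ x ≡ α x ∙ g))

  -- Cay(X,S) is CCA: Aut_c(Cay(X,S)) = X_R ⋊ Aut_{±1}(X,S)
  -- (equality of sets of permutations, functions compared pointwise)
  IsCCA : (Carrier → Set) → Set
  IsCCA S = (∀ φ → AutC S φ → InRegAut S φ) × (∀ φ → InRegAut S φ → AutC S φ)

  CCAGroup : Set₁
  CCAGroup = ∀ (S : Carrier → Set) → InvClosed S → Connected S → IsCCA S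

  NonCCA : Set₁
  NonCCA = ¬ CCAGroup

-- Let T be the connection set of X consisting of the elements of S placed in a
-- single coordinate, together with all of H. For ω ∈ Ω, the map twisting the
-- coordinate h(ω) of (f , h) by τ is a colour-preserving automorphism of
-- Cay(X,T) fixing the identity: left multiplication by H carries the twisted
-- coordinate along, and on that coordinate the map behaves like τ on Cay(G,S).
-- If Cay(X,T) were CCA, the twist would therefore be a group automorphism of X.
-- On the copy of G in coordinate ω this makes τ a homomorphism; and if some
-- h ∈ H moves ω, comparing the twist of (g in coordinate ω)·h with the product
-- of the twists gives τ(g) = g for every g, contradicting τ ≠ 1.

module Submission where

open import Defs
open import Level using (0ℓ)
open import Data.Nat using (ℕ; suc; _≤_)
open import Data.Fin using (Fin; zero; suc)
open import Data.Fin.Properties using (_≟_; ¬∀⟶∃¬)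
open import Data.Vec using (Vec; _∷_; lookup; replicate; map; zipWith; updateAt; _[_]≔_)
open import Data.Vec.Properties
  using (lookup∘tabulate; lookup-replicate; lookup-zipWith; lookup∘updateAt; lookup∘updateAt′; lookup∘update; lookup∘update′;
         updateAt-id-local; updateAt-updateAt; updateAt-updateAt-local; updateAt-commutes;
         updateAt-cong-local; map-[]≔; map-replicate; zipWith-identityˡ; zipWith-identityʳ)
open import Data.Vec.Relation.Binary.Pointwise.Extensional using (ext; Pointwise-≡⇒≡)
open import Data.List using (List; []; _∷_; _++_; allFin)
open import Data.List.Properties using (foldr-++)
open import Data.List.Relation.Unary.All using (All; []; _∷_)
open import Data.List.Relation.Unary.All.Properties using (++⁺)
open import Data.List.Relation.Unary.Any using (tail)
open import Data.List.Membership.Propositional using (_∈_)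
open import Data.List.Membership.Propositional.Properties using (∈-allFin)
open import Data.Product using (∃-syntax; _×_; _,_; proj₁; proj₂)
open import Data.Sum using (_⊎_; inj₁; inj₂; [_,_])
open import Data.Empty using (⊥)
open import Function using (_∘_)
open import Relation.Nullary using (¬_; yes; no)
open import Relation.Binary.PropositionalEquality
  using (_≡_; _≢_; refl; sym; trans; cong; cong₂; subst; module ≡-Reasoning)
open import Algebra.Bundles using (Group)
open import Algebra.Structures using (IsGroup)
import Algebra.Properties.Group as GroupProperties

open ≡-Reasoning

module FinGroupProperties (G : FinGroup) where
  open FinGroup G

  group : Group 0ℓ 0ℓ
  group = record { isGroup = isGroup }

  open IsGroup isGroup public using (assoc; identityˡ; identityʳ; inverseˡ; inverseʳ)
  open GroupProperties group public
    using (ε⁻¹≈ε; ⁻¹-involutive; ∙-cancelʳ; identityˡ-unique; //-rightDividesˡ)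

  zipWith-ε[]≔ : ∀ {n} (ω : Fin n) a (f : Vec Carrier n) →
                 zipWith _∙_ (replicate n ε [ ω ]≔ a) f ≡ updateAt f ω (a ∙_)
  zipWith-ε[]≔ zero    a (x ∷ f) = cong (a ∙ x ∷_) (zipWith-identityˡ identityˡ f)
  zipWith-ε[]≔ (suc ω) a (x ∷ f) = cong₂ _∷_ (identityˡ x) (zipWith-ε[]≔ ω a f)

module _ (G : FinGroup) where
  open FinGroup G
  open CayleyNotions raw
  open FinGroupProperties G

  module _ {S} (invS : InvClosed S) {τ τ′ : Carrier → Carrier}
           (τ′∘τ : ∀ x → τ′ (τ x) ≡ x) (τ∘τ′ : ∀ x → τ (τ′ x) ≡ x) where
    private
      invert : ∀ x {z} → τ x ≡ z → τ′ z ≡ x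
      invert x refl = τ′∘τ x

    colourPres-inverse : ColourPres S τ → ColourPres S τ′
    colourPres-inverse col g s Ss with col (τ′ g) s Ss | col (τ′ g) (s ⁻¹) (invS s Ss)
    ... | inj₁ e | _      = inj₁ (invert (s ∙ τ′ g) (trans e (cong (s ∙_) (τ∘τ′ g))))
    ... | inj₂ _ | inj₂ e = inj₂ (invert (s ⁻¹ ∙ τ′ g) (trans e (cong₂ _∙_ (⁻¹-involutive s) (τ∘τ′ g))))
    ... | inj₂ e | inj₁ e′ =
      inj₁ (trans (cong (λ t → τ′ (t ∙ g)) (sym s⁻¹≡s)) (invert (s ∙ τ′ g) (trans e (cong (s ⁻¹ ∙_) (τ∘τ′ g)))))
      where
      -- τ (s ⁻¹ ∙ τ′ g) and τ (s ∙ τ′ g) are both s ⁻¹ ∙ g, so injectivity of τ gives s ⁻¹ = s.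
      s⁻¹≡s : s ⁻¹ ≡ s
      s⁻¹≡s = ∙-cancelʳ (τ′ g) (s ⁻¹) s
        (trans (sym (τ′∘τ _)) (trans (cong τ′ (trans e′ (sym e))) (τ′∘τ _)))

module Walks (X : RawGrp) (T : RawGrp.Carrier X → Set) where
  open RawGrp X
  open CayleyNotions X

  Reachable : Carrier → Carrier → Set
  Reachable x y = ∃[ ss ] (All T ss × y ≡ applyWord ss x)

  reachable-refl : ∀ {x} → Reachable x x
  reachable-refl = [] , [] , refl

  reachable-step : ∀ {x s} → T s → Reachable x (s ∙ x)
  reachable-step Ts = _ ∷ [] , Ts ∷ [] , refl

  reachable-trans : ∀ {x y z} → Reachable x y → Reachable y z → Reachable x z
  reachable-trans {x} (ss , Tss , refl) (tt , Ttt , refl) = tt ++ ss , ++⁺ Ttt Tss , sym (foldr-++ _∙_ x tt ss)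

  reachable-≡ : ∀ {x y z} → Reachable x y → y ≡ z → Reachable x z
  reachable-≡ r refl = r

module WreathProduct (G H : FinGroup) {k : ℕ} (A : PermAction H k) where
  private
    module G = FinGroup G
    module H = FinGroup H
    module G′ = FinGroupProperties G
    module H′ = FinGroupProperties H
  open G using (_∙_; _⁻¹)
  open PermAction A

  X : RawGrp
  X = Wreath G H A

  open RawGrp X public using () renaming (_∙_ to _⊗_; ε to 1X; _⁻¹ to _⁻¹X)

  V : Set
  V = Vec G.Carrier k

  one : V
  one = replicate k G.ε

  infixr 8 _·_
  _·_ : H.Carrier → V → V
  h · f = permute G H A h f

  act-inverseˡ : ∀ h ω → act (h H.⁻¹) (act h ω) ≡ ω
  act-inverseˡ h ω = begin
    act (h H.⁻¹) (act h ω) ≡⟨ act-∙ (h H.⁻¹) h ω ⟨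
    act (h H.⁻¹ H.∙ h) ω   ≡⟨ cong (λ x → act x ω) (H′.inverseˡ h) ⟩
    act H.ε ω              ≡⟨ act-ε ω ⟩
    ω                      ∎

  act-inverseʳ : ∀ h ω → act h (act (h H.⁻¹) ω) ≡ ω
  act-inverseʳ h ω = begin
    act h (act (h H.⁻¹) ω) ≡⟨ act-∙ h (h H.⁻¹) ω ⟨
    act (h H.∙ h H.⁻¹) ω   ≡⟨ cong (λ x → act x ω) (H′.inverseʳ h) ⟩
    act H.ε ω              ≡⟨ act-ε ω ⟩
    ω                      ∎

  lookup-· : ∀ h f ω → lookup (h · f) ω ≡ lookup f (act (h H.⁻¹) ω)
  lookup-· h f = lookup∘tabulate (λ ω → lookup f (act (h H.⁻¹) ω))

  ε-· : ∀ f → H.ε · f ≡ f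
  ε-· f = Pointwise-≡⇒≡ (ext λ ω → trans (lookup-· H.ε f ω)
    (cong (lookup f) (trans (cong (λ x → act x ω) H′.ε⁻¹≈ε) (act-ε ω))))

  ·-one : ∀ h → h · one ≡ one
  ·-one h = Pointwise-≡⇒≡ (ext λ ω → trans (lookup-· h one ω)
    (trans (lookup-replicate (act (h H.⁻¹) ω) G.ε) (sym (lookup-replicate ω G.ε))))

  ·-updateAt : ∀ h f ω σ → h · updateAt f ω σ ≡ updateAt (h · f) (act h ω) σ
  ·-updateAt h f ω σ = Pointwise-≡⇒≡ (ext pointwise)
    where
    pointwise : ∀ i → lookup (h · updateAt f ω σ) i ≡ lookup (updateAt (h · f) (act h ω) σ) i
    pointwise i with i ≟ act h ω
    ... | yes refl = begin
      lookup (h · updateAt f ω σ) (act h ω)  ≡⟨ lookup-· h (updateAt f ω σ) (act h ω) ⟩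
      lookup (updateAt f ω σ) (act (h H.⁻¹) (act h ω)) ≡⟨ cong (lookup (updateAt f ω σ)) (act-inverseˡ h ω) ⟩
      lookup (updateAt f ω σ) ω              ≡⟨ lookup∘updateAt ω f ⟩
      σ (lookup f ω)                         ≡⟨ cong (σ ∘ lookup f) (act-inverseˡ h ω) ⟨
      σ (lookup f (act (h H.⁻¹) (act h ω)))  ≡⟨ cong σ (lookup-· h f (act h ω)) ⟨
      σ (lookup (h · f) (act h ω))           ≡⟨ lookup∘updateAt (act h ω) (h · f) ⟨
      lookup (updateAt (h · f) (act h ω) σ) (act h ω) ∎
    ... | no i≢hω = begin
      lookup (h · updateAt f ω σ) i          ≡⟨ lookup-· h (updateAt f ω σ) i ⟩
      lookup (updateAt f ω σ) (act (h H.⁻¹) i) ≡⟨ lookup∘updateAt′ _ ω moved f ⟩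
      lookup f (act (h H.⁻¹) i)              ≡⟨ lookup-· h f i ⟨
      lookup (h · f) i                       ≡⟨ lookup∘updateAt′ i (act h ω) i≢hω (h · f) ⟨
      lookup (updateAt (h · f) (act h ω) σ) i ∎
      where
      moved : act (h H.⁻¹) i ≢ ω
      moved e = i≢hω (trans (sym (act-inverseʳ h i)) (cong (act h) e))

  ⊗-identityˡ : ∀ x → 1X ⊗ x ≡ x
  ⊗-identityˡ (f , h) = cong₂ _,_ (trans (zipWith-identityˡ G′.identityˡ (H.ε · f)) (ε-· f)) (H′.identityˡ h)

  ⊗-identityʳ : ∀ x → x ⊗ 1X ≡ x
  ⊗-identityʳ (f , h) =
    cong₂ _,_ (trans (cong (zipWith _∙_ f) (·-one h)) (zipWith-identityʳ G′.identityʳ f)) (H′.identityʳ h)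

  ⊗-idempotent⇒1X : ∀ x → x ⊗ x ≡ x → x ≡ 1X
  ⊗-idempotent⇒1X (f , h) e with H′.identityˡ-unique h h (cong proj₂ e)
  ... | refl = cong (_, H.ε) (Pointwise-≡⇒≡ (ext λ ω →
    trans (G′.identityˡ-unique _ _ (idempotent ω)) (sym (lookup-replicate ω G.ε))))
    where
    idempotent : ∀ ω → lookup f ω ∙ lookup f ω ≡ lookup f ω
    idempotent ω = begin
      lookup f ω ∙ lookup f ω                        ≡⟨ lookup-zipWith _∙_ ω f f ⟨
      lookup (zipWith _∙_ f f) ω                     ≡⟨ cong (λ g → lookup (zipWith _∙_ f g) ω) (ε-· f) ⟨
      lookup (zipWith _∙_ f (H.ε · f)) ω             ≡⟨ cong (λ x → lookup (proj₁ x) ω) e ⟩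
      lookup f ω                                     ∎

  inG : Fin k → G.Carrier → RawGrp.Carrier X
  inG ω a = (one [ ω ]≔ a , H.ε)

  inH : H.Carrier → RawGrp.Carrier X
  inH h = (one , h)

  inG-⊗ : ∀ ω a f h → inG ω a ⊗ (f , h) ≡ (updateAt f ω (a ∙_) , h)
  inG-⊗ ω a f h =
    cong₂ _,_ (trans (cong (zipWith _∙_ (one [ ω ]≔ a)) (ε-· f)) (G′.zipWith-ε[]≔ ω a f)) (H′.identityˡ h)

  inH-⊗ : ∀ h f h′ → inH h ⊗ (f , h′) ≡ (h · f , h H.∙ h′)
  inH-⊗ h f h′ = cong (_, h H.∙ h′) (zipWith-identityˡ G′.identityˡ (h · f))

  inG-⊗-inG : ∀ ω a b → inG ω a ⊗ inG ω b ≡ inG ω (a ∙ b)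
  inG-⊗-inG ω a b = trans (inG-⊗ ω a (one [ ω ]≔ b) H.ε) (cong (_, H.ε) (updateAt-updateAt ω one))

  inG-injective : ∀ ω {a b} → inG ω a ≡ inG ω b → a ≡ b
  inG-injective ω {a} {b} e = begin
    a                               ≡⟨ lookup∘update ω one a ⟨
    lookup (proj₁ (inG ω a)) ω      ≡⟨ cong (λ x → lookup (proj₁ x) ω) e ⟩
    lookup (proj₁ (inG ω b)) ω      ≡⟨ lookup∘update ω one b ⟩
    b                               ∎

  map-⁻¹-one : map _⁻¹ one ≡ one
  map-⁻¹-one = trans (map-replicate _⁻¹ G.ε k) (cong (replicate k) G′.ε⁻¹≈ε)

  inG-⁻¹ : ∀ ω a → inG ω a ⁻¹X ≡ inG ω (a ⁻¹)
  inG-⁻¹ ω a = cong₂ _,_ (begin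
    (H.ε H.⁻¹) · map _⁻¹ (one [ ω ]≔ a) ≡⟨ cong (_· map _⁻¹ (one [ ω ]≔ a)) H′.ε⁻¹≈ε ⟩
    H.ε · map _⁻¹ (one [ ω ]≔ a)        ≡⟨ ε-· _ ⟩
    map _⁻¹ (one [ ω ]≔ a)              ≡⟨ map-[]≔ _⁻¹ one ω ⟩
    map _⁻¹ one [ ω ]≔ a ⁻¹             ≡⟨ cong (_[ ω ]≔ a ⁻¹) map-⁻¹-one ⟩
    one [ ω ]≔ a ⁻¹                     ∎) H′.ε⁻¹≈ε

  inH-⁻¹ : ∀ h → inH h ⁻¹X ≡ inH (h H.⁻¹)
  inH-⁻¹ h = cong (_, h H.⁻¹) (trans (cong ((h H.⁻¹) ·_) map-⁻¹-one) (·-one (h H.⁻¹)))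

  open CayleyNotions X

  regular⇒homomorphism : ∀ {T φ} → InRegAut T φ → φ 1X ≡ 1X → ∀ x y → φ (x ⊗ y) ≡ φ x ⊗ φ y
  regular⇒homomorphism {φ = φ} (g , α , ((_ , α-hom) , _) , φ≡α⊗g) φ1≡1 x y = begin
    φ (x ⊗ y)            ≡⟨ φ≡α (x ⊗ y) ⟩
    α (x ⊗ y)            ≡⟨ α-hom x y ⟩
    α x ⊗ α y            ≡⟨ cong₂ _⊗_ (φ≡α x) (φ≡α y) ⟨
    φ x ⊗ φ y            ∎
    where
    α1≡1 : α 1X ≡ 1X
    α1≡1 = ⊗-idempotent⇒1X (α 1X) (trans (sym (α-hom 1X 1X)) (cong α (⊗-identityˡ 1X)))

    g≡1 : g ≡ 1X
    g≡1 = begin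
      g          ≡⟨ ⊗-identityˡ g ⟨
      1X ⊗ g     ≡⟨ cong (_⊗ g) α1≡1 ⟨
      α 1X ⊗ g   ≡⟨ φ≡α⊗g 1X ⟨
      φ 1X       ≡⟨ φ1≡1 ⟩
      1X         ∎

    φ≡α : ∀ x → φ x ≡ α x
    φ≡α x = trans (φ≡α⊗g x) (trans (cong (α x ⊗_) g≡1) (⊗-identityʳ (α x)))

  data Connection (S : G.Carrier → Set) : RawGrp.Carrier X → Set where
    coordinate  : ∀ ω {a} → S a → Connection S (inG ω a)
    permutation : ∀ h → Connection S (inH h)

  connection-invClosed : ∀ {S} → CayleyNotions.InvClosed G.raw S → InvClosed (Connection S)
  connection-invClosed invS _ (coordinate ω {a} Sa) =
    subst (Connection _) (sym (inG-⁻¹ ω a)) (coordinate ω (invS a Sa))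
  connection-invClosed invS _ (permutation h) =
    subst (Connection _) (sym (inH-⁻¹ h)) (permutation (h H.⁻¹))

  twist : Fin k → (G.Carrier → G.Carrier) → RawGrp.Carrier X → RawGrp.Carrier X
  twist ω σ (f , h) = (updateAt f (act h ω) σ , h)

  twist-inverse : ∀ ω {σ σ′} → (∀ a → σ′ (σ a) ≡ a) → ∀ x → twist ω σ′ (twist ω σ x) ≡ x
  twist-inverse ω σ′∘σ (f , h) =
    cong (_, h) (trans (updateAt-updateAt (act h ω) f) (updateAt-id-local (act h ω) f (σ′∘σ _)))

  twist-inH : ∀ ω {σ} → σ G.ε ≡ G.ε → ∀ h → twist ω σ (inH h) ≡ inH h
  twist-inH ω {σ} σε≡ε h = cong (_, h) (updateAt-id-local (act h ω) one (begin
    σ (lookup one (act h ω))  ≡⟨ cong σ (lookup-replicate (act h ω) G.ε) ⟩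
    σ G.ε                     ≡⟨ σε≡ε ⟩
    G.ε                       ≡⟨ lookup-replicate (act h ω) G.ε ⟨
    lookup one (act h ω)      ∎))

  twist-inG : ∀ ω σ a → twist ω σ (inG ω a) ≡ inG ω (σ a)
  twist-inG ω σ a = cong (_, H.ε)
    (trans (cong (λ c → updateAt (one [ ω ]≔ a) c σ) (act-ε ω)) (updateAt-updateAt ω one))

  module _ {S : G.Carrier → Set} (ω : Fin k) {σ : G.Carrier → G.Carrier}
           (σ-colourPres : CayleyNotions.ColourPres G.raw S σ) where

    private
      twist-inG-⊗-moved : ∀ {ω′} a f h → ω′ ≢ act h ω →
        twist ω σ (inG ω′ a ⊗ (f , h)) ≡ inG ω′ a ⊗ twist ω σ (f , h)
      twist-inG-⊗-moved {ω′} a f h ω′≢c = begin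
        twist ω σ (inG ω′ a ⊗ (f , h))               ≡⟨ cong (twist ω σ) (inG-⊗ ω′ a f h) ⟩
        (updateAt (updateAt f ω′ (a ∙_)) c σ , h)  ≡⟨ cong (_, h) (updateAt-commutes c ω′ (ω′≢c ∘ sym) f) ⟩
        (updateAt (updateAt f c σ) ω′ (a ∙_) , h)  ≡⟨ inG-⊗ ω′ a (updateAt f c σ) h ⟨
        inG ω′ a ⊗ twist ω σ (f , h)               ∎
        where c = act h ω

      twist-inG-⊗-fixed : ∀ a b f h → let c = act h ω in σ (a ∙ lookup f c) ≡ b ∙ σ (lookup f c) →
        twist ω σ (inG c a ⊗ (f , h)) ≡ inG c b ⊗ twist ω σ (f , h)
      twist-inG-⊗-fixed a b f h e = begin
        twist ω σ (inG c a ⊗ (f , h))               ≡⟨ cong (twist ω σ) (inG-⊗ c a f h) ⟩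
        (updateAt (updateAt f c (a ∙_)) c σ , h)  ≡⟨ cong (_, h) (updateAt-updateAt-local c f e) ⟩
        (updateAt f c ((b ∙_) ∘ σ) , h)            ≡⟨ cong (_, h) (updateAt-updateAt c f) ⟨
        (updateAt (updateAt f c σ) c (b ∙_) , h)  ≡⟨ inG-⊗ c b (updateAt f c σ) h ⟨
        inG c b ⊗ twist ω σ (f , h)               ∎
        where c = act h ω

      twist-inH-⊗ : ∀ h′ f h → twist ω σ (inH h′ ⊗ (f , h)) ≡ inH h′ ⊗ twist ω σ (f , h)
      twist-inH-⊗ h′ f h = begin
        twist ω σ (inH h′ ⊗ (f , h))                            ≡⟨ cong (twist ω σ) (inH-⊗ h′ f h) ⟩
        (updateAt (h′ · f) (act (h′ H.∙ h) ω) σ , h′ H.∙ h)     ≡⟨ cong (λ c → updateAt (h′ · f) c σ , h′ H.∙ h) (act-∙ h′ h ω) ⟩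
        (updateAt (h′ · f) (act h′ (act h ω)) σ , h′ H.∙ h)     ≡⟨ cong (_, h′ H.∙ h) (·-updateAt h′ f (act h ω) σ) ⟨
        (h′ · updateAt f (act h ω) σ , h′ H.∙ h)                ≡⟨ inH-⊗ h′ (updateAt f (act h ω) σ) h ⟨
        inH h′ ⊗ twist ω σ (f , h)                              ∎

    twist-colourPres : ColourPres (Connection S) (twist ω σ)
    twist-colourPres (f , h) _ (permutation h′) = inj₁ (twist-inH-⊗ h′ f h)
    twist-colourPres (f , h) _ (coordinate ω′ {a} Sa) with ω′ ≟ act h ω
    ... | no ω′≢c = inj₁ (twist-inG-⊗-moved a f h ω′≢c)
    ... | yes refl with σ-colourPres (lookup f ω′) a Sa
    ...   | inj₁ e = inj₁ (twist-inG-⊗-fixed a a f h e)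
    ...   | inj₂ e = inj₂ (trans (twist-inG-⊗-fixed a (a ⁻¹) f h e) (cong (_⊗ twist ω σ (f , h)) (sym (inG-⁻¹ ω′ a))))

  module _ {S : G.Carrier → Set} (S-generates : CayleyNotions.Generates G.raw S) where
    open Walks X (Connection S)

    private
      reachable-word : ∀ ω f h ss → All S ss →
        Reachable (f , h) (updateAt f ω (CayleyNotions.applyWord G.raw ss G.ε ∙_) , h)
      reachable-word ω f h [] [] =
        reachable-≡ reachable-refl (cong (_, h) (sym (updateAt-id-local ω f (G′.identityˡ _))))
      reachable-word ω f h (s ∷ ss) (Ss ∷ Sss) = reachable-trans (reachable-word ω f h ss Sss)
        (reachable-≡ (reachable-step (coordinate ω Ss)) (trans (inG-⊗ ω s _ h)
          (cong (_, h) (updateAt-updateAt-local ω f (sym (G′.assoc s _ _))))))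

      reachable-[]≔ : ∀ ω b f h → Reachable (f , h) (f [ ω ]≔ b , h)
      reachable-[]≔ ω b f h with S-generates (b ∙ lookup f ω ⁻¹)
      ... | ss , Sss , g≡ss = reachable-≡ (reachable-word ω f h ss Sss)
        (cong (_, h) (updateAt-cong-local ω f (begin
          CayleyNotions.applyWord G.raw ss G.ε ∙ lookup f ω ≡⟨ cong (_∙ lookup f ω) g≡ss ⟨
          b ∙ lookup f ω ⁻¹ ∙ lookup f ω                   ≡⟨ G′.//-rightDividesˡ (lookup f ω) b ⟩
          b                                                ∎)))

      overwrite : List (Fin k) → V → V → V
      overwrite []       w f = f
      overwrite (ω ∷ ωs) w f = overwrite ωs w f [ ω ]≔ lookup w ω

      lookup-overwrite : ∀ ωs w f {i} → i ∈ ωs → lookup (overwrite ωs w f) i ≡ lookup w i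
      lookup-overwrite (ω ∷ ωs) w f {i} i∈ with i ≟ ω
      ... | yes refl = lookup∘update i (overwrite ωs w f) (lookup w i)
      ... | no i≢ω   = trans (lookup∘update′ i≢ω (overwrite ωs w f) (lookup w ω))
                             (lookup-overwrite ωs w f (tail i≢ω i∈))

      reachable-overwrite : ∀ ωs w f h → Reachable (f , h) (overwrite ωs w f , h)
      reachable-overwrite []       w f h = reachable-refl
      reachable-overwrite (ω ∷ ωs) w f h =
        reachable-trans (reachable-overwrite ωs w f h) (reachable-[]≔ ω (lookup w ω) (overwrite ωs w f) h)

      reachable-fibre : ∀ f w h → Reachable (f , h) (w , h)
      reachable-fibre f w h = reachable-≡ (reachable-overwrite (allFin k) w f h)
        (cong (_, h) (Pointwise-≡⇒≡ (ext λ i → lookup-overwrite (allFin k) w f (∈-allFin i))))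

    connection-connected : Connected (Connection S)
    connection-connected (f , h) (w , h′) = reachable-trans
      (reachable-≡ (reachable-step (permutation (h′ H.∙ h H.⁻¹)))
        (trans (inH-⊗ _ f h) (cong ((h′ H.∙ h H.⁻¹) · f ,_) (H′.//-rightDividesˡ h h′))))
      (reachable-fibre _ w h′)

  module _ (ω : Fin k) {σ : G.Carrier → G.Carrier}
           (twist-hom : ∀ x y → twist ω σ (x ⊗ y) ≡ twist ω σ x ⊗ twist ω σ y) where

    twist-homomorphism⇒homomorphism : ∀ a b → σ (a ∙ b) ≡ σ a ∙ σ b
    twist-homomorphism⇒homomorphism a b = inG-injective ω (begin
      inG ω (σ (a ∙ b))                    ≡⟨ twist-inG ω σ (a ∙ b) ⟨
      twist ω σ (inG ω (a ∙ b))            ≡⟨ cong (twist ω σ) (inG-⊗-inG ω a b) ⟨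
      twist ω σ (inG ω a ⊗ inG ω b)        ≡⟨ twist-hom (inG ω a) (inG ω b) ⟩
      twist ω σ (inG ω a) ⊗ twist ω σ (inG ω b) ≡⟨ cong₂ _⊗_ (twist-inG ω σ a) (twist-inG ω σ b) ⟩
      inG ω (σ a) ⊗ inG ω (σ b)            ≡⟨ inG-⊗-inG ω (σ a) (σ b) ⟩
      inG ω (σ a ∙ σ b)                    ∎)

    -- At coordinate ω, twist (inG ω g ⊗ inH h) keeps g because h moves ω,
    -- whereas the product of the twists carries σ g.
    twist-homomorphism⇒identity : ∀ {h} → act h ω ≢ ω → σ G.ε ≡ G.ε → ∀ g → σ g ≡ g
    twist-homomorphism⇒identity {h} hω≢ω σε≡ε g = sym (G′.∙-cancelʳ G.ε g (σ g) (begin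
      g ∙ G.ε                                                    ≡⟨ cong (g ∙_) (lookup-replicate ω G.ε) ⟨
      g ∙ lookup one ω                                           ≡⟨ lookup∘updateAt ω one ⟨
      lookup (updateAt one ω (g ∙_)) ω                           ≡⟨ lookup∘updateAt′ ω (act h ω) (hω≢ω ∘ sym) (updateAt one ω (g ∙_)) ⟨
      at ω (twist ω σ (updateAt one ω (g ∙_) , h))               ≡⟨ cong (at ω ∘ twist ω σ) (inG-⊗ ω g one h) ⟨
      at ω (twist ω σ (inG ω g ⊗ inH h))                         ≡⟨ cong (at ω) (twist-hom (inG ω g) (inH h)) ⟩
      at ω (twist ω σ (inG ω g) ⊗ twist ω σ (inH h))             ≡⟨ cong (at ω) (cong₂ _⊗_ (twist-inG ω σ g) (twist-inH ω σε≡ε h)) ⟩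
      at ω (inG ω (σ g) ⊗ inH h)                                 ≡⟨ cong (at ω) (inG-⊗ ω (σ g) one h) ⟩
      lookup (updateAt one ω (σ g ∙_)) ω                         ≡⟨ lookup∘updateAt ω one ⟩
      σ g ∙ lookup one ω                                         ≡⟨ cong (σ g ∙_) (lookup-replicate ω G.ε) ⟩
      σ g ∙ G.ε                                                  ∎))
      where
      at : Fin k → RawGrp.Carrier X → G.Carrier
      at i x = lookup (proj₁ x) i

proposition3p1 : (G H : FinGroup) (k : ℕ) → 1 ≤ k → (A : PermAction H k) →
    (S : FinGroup.Carrier G → Set) →
    CayleyNotions.InvClosed (FinGroup.raw G) S →
    CayleyNotions.Generates (FinGroup.raw G) S →
    (τ : FinGroup.Carrier G → FinGroup.Carrier G) →
    CayleyNotions.IsBijection (FinGroup.raw G) τ →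
    (∃[ g ] (τ g ≢ g)) →
    τ (FinGroup.ε G) ≡ FinGroup.ε G →
    (∀ g s → S s →
      (τ (FinGroup._∙_ G s g) ≡ FinGroup._∙_ G s (τ g))
      ⊎ (τ (FinGroup._∙_ G s g) ≡ FinGroup._∙_ G (FinGroup._⁻¹ G s) (τ g))) →
    ((∃[ h ] (h ≢ FinGroup.ε H)) ⊎ ¬ CayleyNotions.IsAut (FinGroup.raw G) τ) →
    CayleyNotions.NonCCA (Wreath G H A)
proposition3p1 G H (suc _) _ A S invS S-generates τ (τ′ , τ′∘τ , τ∘τ′) (g , τg≢g) τε≡ε τ-colourPres
               H≢1⊎τ∉Aut CCA = [ H≢1-case , τ∉Aut-case ] H≢1⊎τ∉Aut
  where
  open WreathProduct G H A
  open PermAction A using (act; faithful)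

  twist-hom : ∀ ω x y → twist ω τ (x ⊗ y) ≡ twist ω τ x ⊗ twist ω τ y
  twist-hom ω = regular⇒homomorphism
    (proj₁ (CCA (Connection S) (connection-invClosed invS) (connection-connected S-generates))
      (twist ω τ)
      ( twist ω τ′ , twist-inverse ω τ′∘τ , twist-inverse ω τ∘τ′
      , twist-colourPres ω τ-colourPres
      , twist-colourPres ω (colourPres-inverse G invS τ′∘τ τ∘τ′ τ-colourPres)))
    (twist-inH ω τε≡ε (FinGroup.ε H))

  τ∉Aut-case : ¬ CayleyNotions.IsAut (FinGroup.raw G) τ → ⊥
  τ∉Aut-case τ∉Aut = τ∉Aut ((τ′ , τ′∘τ , τ∘τ′) , twist-homomorphism⇒homomorphism zero (twist-hom zero))

  H≢1-case : ∃[ h ] (h ≢ FinGroup.ε H) → ⊥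
  H≢1-case (h , h≢1) with ¬∀⟶∃¬ _ (λ ω → act h ω ≡ ω) (λ ω → act h ω ≟ ω) (h≢1 ∘ faithful h)
  ... | ω , hω≢ω = τg≢g (twist-homomorphism⇒identity ω (twist-hom ω) hω≢ω τε≡ε g)
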